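{- Let $k$ be a positive integer and let $T$ be a rooted caterpillar with root $r$ having $k$ vertices not counting the root (so $T$ has $k+1$ vertices and $k$ edges). Let $P$ be a longest path in $T$, and suppose the root $r$ is at distance $1$ from an endpoint of $P$. Then $T$ has a $k$-cordial labeling $f: V(T) \to \mathbb{Z}_k$ in which every element of $\mathbb{Z}_k$ appears as an edge weight exactly once.
   Context: All graphs are finite and simple. A caterpillar is a tree $T$ such that, for a maximum (longest) path $P$ of $T$, every vertex of $T$ is at distance at most one from $P$. For an integer $k>0$, a $k$-cordial labeling of a tree $T$ is a map $f:V(T)\to\mathbb{Z}_k$, inducing edge weights $f(uv)=f(u)+f(v) \pmod k$, such that each label appears on at most one more vertex than any other label and each weight appears on at most one more edge than any other weight. -}

module Defs where

open import Data.Nat using (ℕ; zero; suc; _+_; _≤_; _<?_; NonZero)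
open import Data.Nat.DivMod using (_mod_)
open import Data.Fin using (Fin; toℕ)
open import Data.Fin.Properties using (_≟_)
open import Data.Bool using (Bool; true; false; T)
open import Data.Bool.Properties using (T?)
open import Data.List using (List; []; _∷_; _++_; [_]; length; filter; allFin; cartesianProduct)
open import Data.List.Relation.Unary.Unique.Propositional using (Unique)
open import Data.List.Relation.Unary.Linked using (Linked)
open import Data.Product using (Σ; ∃; _×_; _,_; proj₁; proj₂)
open import Data.Sum using (_⊎_)
open import Relation.Nullary using (¬_)
open import Relation.Nullary.Decidable using (_×-dec_)
open import Relation.Binary.PropositionalEquality using (_≡_)

record SimpleGraph (n : ℕ) : Set where
  field
    adj   : Fin n → Fin n → Bool
    sym   : ∀ u v → adj u v ≡ adj v u
    irref : ∀ v → adj v v ≡ false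

open SimpleGraph public

module _ {n : ℕ} (G : SimpleGraph n) where

  Adj : Fin n → Fin n → Set
  Adj u v = adj G u v ≡ true

  IsPath : List (Fin n) → Set
  IsPath P = (¬ P ≡ []) × Unique P × Linked Adj P

  IsEndpoint : Fin n → List (Fin n) → Set
  IsEndpoint v P = (∃ λ rest → P ≡ v ∷ rest) ⊎ (∃ λ init → P ≡ init ++ [ v ])

  PathFromTo : Fin n → Fin n → List (Fin n) → Set
  PathFromTo u v P = IsPath P × (∃ λ rest → P ≡ u ∷ rest) × (∃ λ init → P ≡ init ++ [ v ])

  Connected : Set
  Connected = ∀ u v → ∃ λ P → PathFromTo u v P

  HasCycle : Set
  HasCycle = Σ (Fin n) λ u → Σ (List (Fin n)) λ mid → Σ (Fin n) λ v →
               IsPath (u ∷ mid ++ [ v ]) × (¬ mid ≡ []) × Adj v u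

  IsTree : Set
  IsTree = Connected × ¬ HasCycle

  IsLongestPath : List (Fin n) → Set
  IsLongestPath P = IsPath P × (∀ Q → IsPath Q → length Q ≤ length P)

  OnOrAdjacent : Fin n → List (Fin n) → Set
  OnOrAdjacent v P = ∃ λ w → (w Data.List.Membership.Propositional.∈ P) × (v ≡ w ⊎ Adj v w)
    where import Data.List.Membership.Propositional

  IsCaterpillar : Set
  IsCaterpillar = IsTree × (∃ λ P → IsLongestPath P × (∀ v → OnOrAdjacent v P))

  edges : List (Fin n × Fin n)
  edges = filter (λ e → toℕ (proj₁ e) <? toℕ (proj₂ e) ×-dec T? (adj G (proj₁ e) (proj₂ e)))
                 (cartesianProduct (allFin n) (allFin n))

_+ₖ_ : {k : ℕ} .{{_ : NonZero k}} → Fin k → Fin k → Fin k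
_+ₖ_ {k} a b = (toℕ a + toℕ b) mod k

module _ {n k : ℕ} .{{_ : NonZero k}} (G : SimpleGraph n) (f : Fin n → Fin k) where

  vcount : Fin k → ℕ
  vcount a = length (filter (λ v → f v ≟ a) (allFin n))

  weight : Fin n × Fin n → Fin k
  weight e = f (proj₁ e) +ₖ f (proj₂ e)

  ecount : Fin k → ℕ
  ecount c = length (filter (λ e → weight e ≟ c) (edges G))

  IsKCordial : Set
  IsKCordial = (∀ a b → vcount a ≤ suc (vcount b)) × (∀ a b → ecount a ≤ suc (ecount b))

module Submission where

-- Order the vertices of the caterpillar along its spine s₀, s₁, …: first s₀, then the leaves of s₀,
-- then s₁, the leaves of s₁, and so on.  Every vertex v ≠ s₀ is preceded by its parent p, a spine
-- vertex of the other colour of the bipartition, and every vertex strictly between p and v has the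
-- colour of v.  Number one colour class 0, 1, … in this order and let the other class continue the
-- numbering.  Then the labels of p and v add up to c + rank v − 1 for a constant c, so the k edge sums
-- are k consecutive integers and every weight occurs exactly once mod k.  The labels 0, …, k taken
-- mod k hit 0 twice and every other residue once, which makes the labelling cordial on vertices.

open import Defs hiding (sym)

open import Level using (0ℓ)
open import Function using (_∘_)
open import Function.Bundles using (Equivalence)
open import Data.Empty using (⊥; ⊥-elim)
open import Data.Unit using (⊤; tt)
open import Data.Bool using (Bool; true; false; not; T)
open import Data.Bool.Properties using (T?; T-≡; not-¬) renaming (_≟_ to _≟ᵇ_)
open import Data.Product using (∃; _×_; _,_; proj₁; proj₂)
open import Data.Sum as Sum using (_⊎_; inj₁; inj₂; [_,_]′)
open import Data.Nat using (ℕ; zero; suc; _+_; _*_; _∸_; _≤_; _<_; z≤n; s≤s; s≤s⁻¹; z<s; s<s; NonZero; _<?_)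
open import Data.Nat.Properties
open import Data.Nat.DivMod using (_%_; _mod_; m<n⇒m%n≡m; m%n<n; %-distribˡ-+; [m+n]%n≡m%n; [m+kn]%n≡m%n)
open import Data.Nat.Tactic.RingSolver using (solve-∀)
open import Data.Fin as Fin using (Fin; toℕ; fromℕ<; punchOut)
open import Data.Fin.Properties using (toℕ<n; toℕ-fromℕ<; toℕ-injective; any?; punchOut-injective; injective⇒≤)
  renaming (_≟_ to _≟ᶠ_)
open import Data.List using (List; []; _∷_; _++_; [_]; length; filter; allFin; applyUpTo; cartesianProduct)
open import Data.List.Properties
  using (++-assoc; length-++; length-applyUpTo; length-tabulate; filter-≐; filter-some; filter-notAll; filter-all; filter-none)
open import Data.List.Relation.Unary.All as All using (All; []; _∷_)
open import Data.List.Relation.Unary.Any using (here; there)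
open import Data.List.Relation.Unary.AllPairs using ([]; _∷_)
open import Data.List.Relation.Unary.Linked using (Linked; [-]; _∷_)
open import Data.List.Relation.Unary.Unique.Propositional using (Unique)
open import Data.List.Relation.Unary.Unique.Propositional.Properties
  using (filter⁺; allFin⁺; cartesianProduct⁺; applyUpTo⁺₁) renaming (++⁺ to Unique-++⁺)
open import Data.List.Membership.Propositional using (_∈_; lose)
open import Data.List.Membership.Propositional.Properties
  using (∈-allFin; ∈-applyUpTo⁻; ∈-filter⁺; ∈-filter⁻; ∈-cartesianProduct⁺)
open import Relation.Nullary using (¬_; Dec; yes; no; contradiction)
open import Relation.Nullary.Decidable using (_×-dec_)
open import Relation.Unary using (Pred; Decidable; _⊆_; _≐_)
open import Relation.Unary.Properties using (_∪?_)
open import Relation.Binary.Definitions using (tri<; tri≈; tri>)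
open import Relation.Binary.PropositionalEquality
  using (_≡_; _≢_; refl; sym; trans; cong; cong₂; subst; subst₂; module ≡-Reasoning)

private variable
  A : Set

count : {P : Pred A 0ℓ} → Decidable P → List A → ℕ
count P? xs = length (filter P? xs)

module _ {P Q : Pred A 0ℓ} (P? : Decidable P) (Q? : Decidable Q) where

  count-≐ : P ≐ Q → ∀ xs → count P? xs ≡ count Q? xs
  count-≐ P≐Q xs = cong length (filter-≐ P? Q? P≐Q xs)

  count-mono-≤ : P ⊆ Q → ∀ xs → count P? xs ≤ count Q? xs
  count-mono-≤ P⊆Q [] = z≤n
  count-mono-≤ P⊆Q (x ∷ xs) with P? x | Q? x
  ... | yes px | yes _  = s≤s (count-mono-≤ P⊆Q xs)
  ... | yes px | no ¬qx = contradiction (P⊆Q px) ¬qx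
  ... | no _   | yes _  = m≤n⇒m≤1+n (count-mono-≤ P⊆Q xs)
  ... | no _   | no _   = count-mono-≤ P⊆Q xs

  count-mono-< : P ⊆ Q → ∀ {x xs} → x ∈ xs → Q x → ¬ P x → count P? xs < count Q? xs
  count-mono-< P⊆Q {xs = y ∷ xs} x∈ qx ¬px with P? y | Q? y | x∈
  ... | yes py | no ¬qy | _        = contradiction (P⊆Q py) ¬qy
  ... | yes py | yes _  | here refl = contradiction py ¬px
  ... | yes _  | yes _  | there x∈′ = s≤s (count-mono-< P⊆Q x∈′ qx ¬px)
  ... | no _   | yes _  | _        = s≤s (count-mono-≤ P⊆Q xs)
  ... | no _   | no ¬qy | here refl = contradiction qx ¬qy
  ... | no _   | no _   | there x∈′ = count-mono-< P⊆Q x∈′ qx ¬px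

  count-∪ : (∀ {x} → P x → ¬ Q x) → ∀ xs → count (P? ∪? Q?) xs ≡ count P? xs + count Q? xs
  count-∪ P⊥Q [] = refl
  count-∪ P⊥Q (x ∷ xs) with P? x | Q? x
  ... | yes px | yes qx = contradiction qx (P⊥Q px)
  ... | yes _  | no _   = cong suc (count-∪ P⊥Q xs)
  ... | no _   | yes _  = trans (cong suc (count-∪ P⊥Q xs)) (sym (+-suc _ _))
  ... | no _   | no _   = count-∪ P⊥Q xs

module _ {P : Pred A 0ℓ} (P? : Decidable P) where

  count-≤1 : ∀ {xs} → Unique xs → (∀ {x y} → x ∈ xs → y ∈ xs → P x → P y → x ≡ y) →
             count P? xs ≤ 1
  count-≤1 {[]}     _              _        = z≤n
  count-≤1 {x ∷ xs} (x∉xs ∷ uniq) P-unique with P? x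
  ... | no _   = count-≤1 uniq (λ y∈ z∈ → P-unique (there y∈) (there z∈))
  ... | yes px = s≤s (≤-reflexive (cong length (filter-none P? (All.tabulate λ y∈ py →
                   All.lookup x∉xs y∈ (P-unique (here refl) (there y∈) px py)))))

  count-≡1 : ∀ {x xs} → Unique xs → x ∈ xs → P x → (∀ {y} → y ∈ xs → P y → y ≡ x) →
             count P? xs ≡ 1
  count-≡1 uniq x∈ px P-only = ≤-antisym
    (count-≤1 uniq (λ y∈ z∈ py pz → trans (P-only y∈ py) (sym (P-only z∈ pz))))
    (filter-some P? (lose x∈ px))

linked-applyUpTo-++ : ∀ {R : A → A → Set} (f : ℕ → A) d {ys} → (∀ {t} → t < d → R (f t) (f (suc t))) →
                      Linked R (f d ∷ ys) → Linked R (applyUpTo f (suc d) ++ ys)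
linked-applyUpTo-++ f zero    step last = last
linked-applyUpTo-++ f (suc d) step last = step z<s ∷ linked-applyUpTo-++ (f ∘ suc) d (step ∘ s<s) last

<⇒≡suc+ : ∀ {i j} → i < j → ∃ λ d → j ≡ suc (d + i)
<⇒≡suc+ {i} {j} i<j = j ∸ suc i , sym (trans (sym (+-suc (j ∸ suc i) i)) (m∸n+n≡m i<j))

≤⇒≡+ : ∀ {i j} → i ≤ j → ∃ λ d → j ≡ d + i
≤⇒≡+ {i} {j} i≤j = j ∸ i , sym (m∸n+n≡m i≤j)

length-allFin : ∀ n → length (allFin n) ≡ n
length-allFin n = length-tabulate (λ i → i)

≢[]⇒0<length : ∀ {xs : List A} → xs ≢ [] → 0 < length xs
≢[]⇒0<length {xs = []}    xs≢[] = contradiction refl xs≢[]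
≢[]⇒0<length {xs = _ ∷ _} _     = z<s

module _ {A : Set} (default : A) where

  nth : List A → ℕ → A
  nth []       _       = default
  nth (x ∷ xs) zero    = x
  nth (x ∷ xs) (suc i) = nth xs i

  nth-∈ : ∀ {xs i} → i < length xs → nth xs i ∈ xs
  nth-∈ {x ∷ xs} {zero}  _       = here refl
  nth-∈ {x ∷ xs} {suc i} 1+i<len = there (nth-∈ (s≤s⁻¹ 1+i<len))

  ∈⇒nth : ∀ {x xs} → x ∈ xs → ∃ λ i → i < length xs × nth xs i ≡ x
  ∈⇒nth (here refl) = 0 , z<s , refl
  ∈⇒nth (there x∈)  = let i , i<len , eq = ∈⇒nth x∈ in suc i , s<s i<len , eq

  nth-injective : ∀ {xs} → Unique xs → ∀ {i j} → i < length xs → j < length xs →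
                  nth xs i ≡ nth xs j → i ≡ j
  nth-injective {x ∷ xs} _          {zero}  {zero}  _  _  _  = refl
  nth-injective {x ∷ xs} (x∉ ∷ _)   {zero}  {suc j} _  j< eq =
    contradiction eq (All.lookup x∉ (nth-∈ (s≤s⁻¹ j<)))
  nth-injective {x ∷ xs} (x∉ ∷ _)   {suc i} {zero}  i< _  eq =
    contradiction (sym eq) (All.lookup x∉ (nth-∈ (s≤s⁻¹ i<)))
  nth-injective {x ∷ xs} (_ ∷ uniq) {suc i} {suc j} i< j< eq =
    cong suc (nth-injective uniq (s≤s⁻¹ i<) (s≤s⁻¹ j<) eq)

  nth-linked : ∀ {R : A → A → Set} {xs} → Linked R xs →
               ∀ {i} → suc i < length xs → R (nth xs i) (nth xs (suc i))
  nth-linked [-]          (s≤s ())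
  nth-linked (r ∷ _)      {zero}  _       = r
  nth-linked (_ ∷ linked) {suc i} 2+i<len = nth-linked linked (s≤s⁻¹ 2+i<len)

module _ {d : ℕ} .{{_ : NonZero d}} where

  [m+n]%d≡[m%d+n]%d : ∀ m {n} → n < d → (m + n) % d ≡ (m % d + n) % d
  [m+n]%d≡[m%d+n]%d m {n} n<d = trans (%-distribˡ-+ m n d) (cong (λ t → (m % d + t) % d) (m<n⇒m%n≡m n<d))

  [m+n]%d≡m%d⇒n≡0 : ∀ m {n} → n < d → (m + n) % d ≡ m % d → n ≡ 0
  [m+n]%d≡m%d⇒n≡0 m {n} n<d eq with m % d + n <? d
  ... | yes r+n<d = +-cancelˡ-≡ (m % d) n 0 (begin
    m % d + n        ≡⟨ m<n⇒m%n≡m r+n<d ⟨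
    (m % d + n) % d  ≡⟨ [m+n]%d≡[m%d+n]%d m n<d ⟨
    (m + n) % d      ≡⟨ eq ⟩
    m % d            ≡⟨ +-identityʳ (m % d) ⟨
    m % d + 0        ∎)
    where open ≡-Reasoning
  ... | no r+n≮d = contradiction (+-cancelˡ-≡ r n d (trans (sym s+d≡r+n) (cong (_+ d) s≡r))) (<⇒≢ n<d)
    where
    -- Past the wrap-around the residue is s = r + n ∸ d, and s = r forces n = d.
    r s : ℕ
    r = m % d
    s = r + n ∸ d
    s+d≡r+n : s + d ≡ r + n
    s+d≡r+n = m∸n+n≡m (≮⇒≥ r+n≮d)
    s<d : s < d
    s<d = +-cancelʳ-< d s d (subst (_< d + d) (sym s+d≡r+n) (+-mono-< (m%n<n m d) n<d))
    s≡r : s ≡ r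
    s≡r = begin
      s            ≡⟨ m<n⇒m%n≡m s<d ⟨
      s % d        ≡⟨ [m+n]%n≡m%n s d ⟨
      (s + d) % d  ≡⟨ cong (_% d) s+d≡r+n ⟩
      (r + n) % d  ≡⟨ [m+n]%d≡[m%d+n]%d m n<d ⟨
      (m + n) % d  ≡⟨ eq ⟩
      r            ∎
      where open ≡-Reasoning

  [m+i]%d≡[m+j]%d⇒i≡j : ∀ m {i j} → i < d → j < d → (m + i) % d ≡ (m + j) % d → i ≡ j
  [m+i]%d≡[m+j]%d⇒i≡j m {i} {j} i<d j<d eq =
    [ (λ i≤j → ordered i≤j j<d (sym eq)) , (λ j≤i → sym (ordered j≤i i<d eq)) ]′ (≤-total i j)
    where
    ordered : ∀ {i j} → i ≤ j → j < d → (m + j) % d ≡ (m + i) % d → i ≡ j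
    ordered {i} {j} i≤j j<d eq = ≤-antisym i≤j (m∸n≡0⇒m≤n (
      [m+n]%d≡m%d⇒n≡0 (m + i) (≤-<-trans (m∸n≤m j i) j<d)
        (trans (cong (_% d) (trans (+-assoc m i (j ∸ i)) (cong (m +_) (m+[n∸m]≡n i≤j)))) eq)))

toℕ-mod : ∀ m {k} .{{_ : NonZero k}} → toℕ (m mod k) ≡ m % k
toℕ-mod m {k} = toℕ-fromℕ< (m%n<n m k)

Fin-injective⇒onto : ∀ {n} (F : Fin n → Fin n) → (∀ {u v} → F u ≡ F v → u ≡ v) →
                     ∀ y → ∃ λ x → F x ≡ y
Fin-injective⇒onto {suc n} F F-injective y with any? (λ x → F x ≟ᶠ y)
... | yes hit = hit
... | no miss = contradiction (injective⇒≤ punched-injective) 1+n≰n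
  where
  y≢F : ∀ x → y ≢ F x
  y≢F x y≡Fx = miss (x , sym y≡Fx)
  punched : Fin (suc n) → Fin n
  punched x = punchOut (y≢F x)
  punched-injective : ∀ {u v} → punched u ≡ punched v → u ≡ v
  punched-injective eq = F-injective (punchOut-injective (y≢F _) (y≢F _) eq)

injective⇒onto : ∀ {n} (g : Fin n → ℕ) → (∀ v → g v < n) → (∀ {u v} → g u ≡ g v → u ≡ v) →
                 ∀ {t} → t < n → ∃ λ v → g v ≡ t
injective⇒onto {n} g g<n g-injective {t} t<n =
  let v , Gv≡t = Fin-injective⇒onto G G-injective (fromℕ< t<n)
  in v , trans (sym (toℕ-fromℕ< (g<n v))) (trans (cong toℕ Gv≡t) (toℕ-fromℕ< t<n))
  where
  G : Fin n → Fin n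
  G v = fromℕ< (g<n v)
  G-injective : ∀ {u v} → G u ≡ G v → u ≡ v
  G-injective {u} {v} eq = g-injective (begin
    g u          ≡⟨ toℕ-fromℕ< (g<n u) ⟨
    toℕ (G u)    ≡⟨ cong toℕ eq ⟩
    toℕ (G v)    ≡⟨ toℕ-fromℕ< (g<n v) ⟩
    g v          ∎)
    where open ≡-Reasoning

module _ {n : ℕ} (G : SimpleGraph n) where

  Adj-sym : ∀ {u v} → Adj G u v → Adj G v u
  Adj-sym {u} {v} uv = trans (SimpleGraph.sym G v u) uv

  Adj⇒≢ : ∀ {u v} → Adj G u v → u ≢ v
  Adj⇒≢ {u} uv refl with trans (sym uv) (irref G u)
  ... | ()

  private
    edge? : Decidable λ (e : Fin n × Fin n) → toℕ (proj₁ e) < toℕ (proj₂ e) × T (adj G (proj₁ e) (proj₂ e))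
    edge? e = toℕ (proj₁ e) <? toℕ (proj₂ e) ×-dec T? (adj G (proj₁ e) (proj₂ e))

  edges-unique : Unique (edges G)
  edges-unique = filter⁺ edge? (cartesianProduct⁺ (allFin⁺ n) (allFin⁺ n))

  ∈-edges⁺ : ∀ {x y} → toℕ x < toℕ y → Adj G x y → (x , y) ∈ edges G
  ∈-edges⁺ x<y xy =
    ∈-filter⁺ edge? (∈-cartesianProduct⁺ (∈-allFin _) (∈-allFin _)) (x<y , Equivalence.from T-≡ xy)

  ∈-edges⁻ : ∀ {x y} → (x , y) ∈ edges G → toℕ x < toℕ y × Adj G x y
  ∈-edges⁻ e∈ with _ , (x<y , t) ← ∈-filter⁻ edge? {xs = cartesianProduct (allFin n) (allFin n)} e∈ =
    x<y , Equivalence.to T-≡ t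

  orient : Fin n → Fin n → Fin n × Fin n
  orient x y with toℕ x <? toℕ y
  ... | yes _ = x , y
  ... | no  _ = y , x

  orient-< : ∀ {x y} → toℕ x < toℕ y → orient x y ≡ (x , y)
  orient-< {x} {y} x<y with toℕ x <? toℕ y
  ... | yes _   = refl
  ... | no  x≮y = contradiction x<y x≮y

  orient-> : ∀ {x y} → toℕ y < toℕ x → orient x y ≡ (y , x)
  orient-> {x} {y} y<x with toℕ x <? toℕ y
  ... | yes x<y = contradiction x<y (<⇒≯ y<x)
  ... | no  _   = refl

  orient-∈-edges : ∀ {x y} → Adj G x y → orient x y ∈ edges G
  orient-∈-edges {x} {y} xy with <-cmp (toℕ x) (toℕ y)
  ... | tri< x<y _ _ = subst (_∈ edges G) (sym (orient-< x<y)) (∈-edges⁺ x<y xy)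
  ... | tri≈ _ x≡y _ = contradiction (toℕ-injective x≡y) (Adj⇒≢ xy)
  ... | tri> _ _ y<x = subst (_∈ edges G) (sym (orient-> y<x)) (∈-edges⁺ y<x (Adj-sym xy))

module AcyclicPath {n : ℕ} (G : SimpleGraph n) (acyclic : ¬ HasCycle G) {m : ℕ} (path : ℕ → Fin n)
                   (path-injective : ∀ {i j} → i < m → j < m → path i ≡ path j → i ≡ j)
                   (path-adjacent : ∀ {i} → suc i < m → Adj G (path i) (path (suc i))) where

  OffPath : Fin n → Set
  OffPath x = ∀ {i} → i < m → path i ≢ x

  -- The walk path i, …, path (d + i), ext, z closes up into a cycle through the edge z — path i.
  no-closing-detour : ∀ i d ext z → d + i < m → Unique (ext ++ [ z ]) →
                      (∀ {x} → x ∈ ext ++ [ z ] → ∀ {t} → t ≤ d → path (t + i) ≢ x) →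
                      Linked (Adj G) (path (d + i) ∷ ext ++ [ z ]) → Adj G z (path i) →
                      0 < length ext + d → ⊥
  no-closing-detour i d ext z d+i<m uniq off-segment linked closing nonempty =
    acyclic (path i , interior , z , isPath , interior≢[] , closing)
    where
    segment : ℕ → Fin n
    segment t = path (t + i)
    interior : List (Fin n)
    interior = applyUpTo (segment ∘ suc) d ++ ext
    walk≡ : path i ∷ interior ++ [ z ] ≡ applyUpTo segment (suc d) ++ ext ++ [ z ]
    walk≡ = cong (path i ∷_) (++-assoc (applyUpTo (segment ∘ suc) d) ext [ z ])
    t+i<m : ∀ {t} → t < suc d → t + i < m
    t+i<m t<1+d = ≤-<-trans (+-monoˡ-≤ i (s≤s⁻¹ t<1+d)) d+i<m
    segment-unique : Unique (applyUpTo segment (suc d))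
    segment-unique = applyUpTo⁺₁ segment (suc d) λ s<t t<1+d eq →
      <⇒≢ s<t (+-cancelʳ-≡ i _ _ (path-injective (t+i<m (<-trans s<t t<1+d)) (t+i<m t<1+d) eq))
    disjoint : ∀ {x} → ¬ (x ∈ applyUpTo segment (suc d) × x ∈ ext ++ [ z ])
    disjoint (x∈segment , x∈rest) with t , t<1+d , refl ← ∈-applyUpTo⁻ segment x∈segment =
      off-segment x∈rest (s≤s⁻¹ t<1+d) refl
    isPath : IsPath G (path i ∷ interior ++ [ z ])
    isPath = (λ ()) , subst Unique (sym walk≡) (Unique-++⁺ segment-unique uniq disjoint)
           , subst (Linked (Adj G)) (sym walk≡)
               (linked-applyUpTo-++ segment d (λ t<d → path-adjacent (t+i<m (s<s t<d))) linked)
    interior≢[] : interior ≢ []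
    interior≢[] interior≡[] = <⇒≢ nonempty (sym (begin
      length ext + d                                     ≡⟨ +-comm (length ext) d ⟩
      d + length ext                                     ≡⟨ cong (_+ length ext) (length-applyUpTo _ d) ⟨
      length (applyUpTo (segment ∘ suc) d) + length ext  ≡⟨ length-++ (applyUpTo (segment ∘ suc) d) ⟨
      length interior                                    ≡⟨ cong length interior≡[] ⟩
      0                                                  ∎))
      where open ≡-Reasoning

  path-chord-< : ∀ {i j} → i < j → j < m → Adj G (path i) (path j) → j ≡ suc i
  path-chord-< {i} i<j j<m ij with <⇒≡suc+ i<j
  ... | zero  , j≡ = j≡
  ... | suc d , refl = ⊥-elim (no-closing-detour i (suc d) [] (path (suc (suc d + i)))
        (<-trans (n<1+n _) j<m) ([] ∷ []) off-segment (path-adjacent j<m ∷ [-]) (Adj-sym G ij) z<s)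
    where
    off-segment : ∀ {x} → x ∈ [ path (suc (suc d + i)) ] → ∀ {t} → t ≤ suc d → path (t + i) ≢ x
    off-segment (here refl) t≤1+d eq = <⇒≢ (s≤s t≤1+d)
      (+-cancelʳ-≡ i _ _ (path-injective (≤-<-trans (+-monoˡ-≤ i (m≤n⇒m≤1+n t≤1+d)) j<m) j<m eq))

  path-chord : ∀ {i j} → i < m → j < m → Adj G (path i) (path j) → j ≡ suc i ⊎ i ≡ suc j
  path-chord {i} {j} i<m j<m ij with <-cmp i j
  ... | tri< i<j _ _  = inj₁ (path-chord-< i<j j<m ij)
  ... | tri≈ _ refl _ = contradiction refl (Adj⇒≢ G ij)
  ... | tri> _ _ j<i  = inj₂ (path-chord-< j<i i<m (Adj-sym G ij))

  OffPath⇒off-segment : ∀ {i d xs} → d + i < m → All OffPath xs →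
                        ∀ {x} → x ∈ xs → ∀ {t} → t ≤ d → path (t + i) ≢ x
  OffPath⇒off-segment d+i<m offs x∈ t≤d = All.lookup offs x∈ (≤-<-trans (+-monoˡ-≤ _ t≤d) d+i<m)

  off-path-neighbours-< : ∀ {v i j} → OffPath v → i < j → j < m →
                          Adj G v (path i) → Adj G v (path j) → ⊥
  off-path-neighbours-< {v} {i} off i<j j<m vi vj with d , refl ← <⇒≡suc+ i<j =
    no-closing-detour i (suc d) [] v j<m ([] ∷ []) (OffPath⇒off-segment j<m (off ∷ []))
      (Adj-sym G vj ∷ [-]) vi z<s

  off-path-neighbour-unique : ∀ {v i j} → OffPath v → i < m → j < m →
                              Adj G v (path i) → Adj G v (path j) → i ≡ j
  off-path-neighbour-unique off i<m j<m vi vj with <-cmp _ _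
  ... | tri≈ _ i≡j _ = i≡j
  ... | tri< i<j _ _ = ⊥-elim (off-path-neighbours-< off i<j j<m vi vj)
  ... | tri> _ _ j<i = ⊥-elim (off-path-neighbours-< off j<i i<m vj vi)

  off-path-edge-≤ : ∀ {u v i j} → OffPath u → OffPath v → i ≤ j → j < m →
                    Adj G u (path i) → Adj G v (path j) → ¬ Adj G u v
  off-path-edge-≤ {u} {v} {i} offu offv i≤j j<m ui vj uv with d , refl ← ≤⇒≡+ i≤j =
    no-closing-detour i d [ v ] u j<m ((Adj⇒≢ G (Adj-sym G uv) ∷ []) ∷ [] ∷ [])
      (OffPath⇒off-segment j<m (offv ∷ offu ∷ [])) (Adj-sym G vj ∷ Adj-sym G uv ∷ [-]) ui z<s

  off-path-edge : ∀ {u v i j} → OffPath u → OffPath v → i < m → j < m →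
                  Adj G u (path i) → Adj G v (path j) → ¬ Adj G u v
  off-path-edge offu offv i<m j<m ui vj uv with ≤-total _ _
  ... | inj₁ i≤j = off-path-edge-≤ offu offv i≤j j<m ui vj uv
  ... | inj₂ j≤i = off-path-edge-≤ offv offu j≤i i<m vj ui (Adj-sym G uv)

false-or-true : ∀ b → b ≡ false ⊎ b ≡ true
false-or-true false = inj₁ refl
false-or-true true  = inj₂ refl

module ColourMajorLabelling {n : ℕ} (key : Fin n → ℕ) (key-injective : ∀ {u v} → key u ≡ key v → u ≡ v)
                            (colour : Fin n → Bool) where

  _≺_ : Fin n → Fin n → Set
  u ≺ v = key u < key v

  _≺?_ : ∀ u v → Dec (u ≺ v)
  u ≺? v = key u <? key v

  coloured? : ∀ b → Decidable (λ w → colour w ≡ b)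
  coloured? b w = colour w ≟ᵇ b

  colouredBefore? : ∀ b v → Decidable (λ w → colour w ≡ b × w ≺ v)
  colouredBefore? b v w = coloured? b w ×-dec w ≺? v

  rank : Fin n → ℕ
  rank v = count (_≺? v) (allFin n)

  rankIn : Bool → Fin n → ℕ
  rankIn b v = count (colouredBefore? b v) (allFin n)

  classSize : Bool → ℕ
  classSize b = count (coloured? b) (allFin n)

  labelIn : Bool → Fin n → ℕ
  labelIn false v = rankIn false v
  labelIn true  v = classSize false + rankIn true v

  label : Fin n → ℕ
  label v = labelIn (colour v) v

  ≺-mono⇒injective : {C : Fin n → Set} (g : Fin n → ℕ) → (∀ {u v} → C u → u ≺ v → g u < g v) →
                     ∀ {u v} → C u → C v → g u ≡ g v → u ≡ v
  ≺-mono⇒injective g mono {u} {v} cu cv eq with <-cmp (key u) (key v)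
  ... | tri< u≺v _ _ = contradiction eq (<⇒≢ (mono cu u≺v))
  ... | tri≈ _ same _ = key-injective same
  ... | tri> _ _ v≺u = contradiction (sym eq) (<⇒≢ (mono cv v≺u))

  rank<n : ∀ v → rank v < n
  rank<n v = subst (rank v <_) (length-allFin n)
    (filter-notAll (_≺? v) (allFin n) (lose (∈-allFin v) (<-irrefl refl)))

  rank-mono : ∀ {u v} → u ≺ v → rank u < rank v
  rank-mono {u} {v} u≺v =
    count-mono-< (_≺? u) (_≺? v) (λ w≺u → <-trans w≺u u≺v) (∈-allFin u) u≺v (<-irrefl refl)

  rank-injective : ∀ {u v} → rank u ≡ rank v → u ≡ v
  rank-injective = ≺-mono⇒injective {C = λ _ → ⊤} rank (λ _ → rank-mono) tt tt

  rankIn-mono : ∀ {b u v} → colour u ≡ b → u ≺ v → rankIn b u < rankIn b v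
  rankIn-mono {b} {u} {v} cu u≺v =
    count-mono-< (colouredBefore? b u) (colouredBefore? b v) (λ (cw , w≺u) → cw , <-trans w≺u u≺v)
      (∈-allFin u) (cu , u≺v) (λ (_ , u≺u) → <-irrefl refl u≺u)

  rankIn<classSize : ∀ {b v} → colour v ≡ b → rankIn b v < classSize b
  rankIn<classSize {b} {v} cv =
    count-mono-< (colouredBefore? b v) (coloured? b) proj₁ (∈-allFin v) cv (λ (_ , v≺v) → <-irrefl refl v≺v)

  classSize-sum : classSize false + classSize true ≡ n
  classSize-sum = begin
    classSize false + classSize true
      ≡⟨ count-∪ (coloured? false) (coloured? true) not-¬ (allFin n) ⟨
    count (coloured? false ∪? coloured? true) (allFin n)
      ≡⟨ cong length (filter-all _ (All.universal (false-or-true ∘ colour) (allFin n))) ⟩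
    length (allFin n)
      ≡⟨ length-allFin n ⟩
    n ∎
    where open ≡-Reasoning

  rank-split : ∀ v → rank v ≡ rankIn false v + rankIn true v
  rank-split v = begin
    rank v
      ≡⟨ count-≐ (_≺? v) (colouredBefore? false v ∪? colouredBefore? true v) split (allFin n) ⟩
    count (colouredBefore? false v ∪? colouredBefore? true v) (allFin n)
      ≡⟨ count-∪ _ _ (λ (cf , _) (ct , _) → not-¬ cf ct) (allFin n) ⟩
    rankIn false v + rankIn true v ∎
    where
    open ≡-Reasoning
    split : (_≺ v) ≐ (λ w → (colour w ≡ false × w ≺ v) ⊎ (colour w ≡ true × w ≺ v))
    split = (λ {w} w≺v → Sum.map (_, w≺v) (_, w≺v) (false-or-true (colour w))) , [ proj₂ , proj₂ ]′

  label<n : ∀ v → label v < n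
  label<n v with colour v in cv
  ... | false = <-≤-trans (rankIn<classSize cv) (subst (classSize false ≤_) classSize-sum (m≤m+n _ _))
  ... | true  = subst (classSize false + rankIn true v <_) classSize-sum (+-monoʳ-< _ (rankIn<classSize cv))

  label-injective : ∀ {u v} → label u ≡ label v → u ≡ v
  label-injective {u} {v} eq with colour u in cu | colour v in cv
  ... | false | false = ≺-mono⇒injective (rankIn false) rankIn-mono cu cv eq
  ... | true  | true  = ≺-mono⇒injective (rankIn true) rankIn-mono cu cv (+-cancelˡ-≡ (classSize false) _ _ eq)
  ... | false | true  = contradiction eq (<⇒≢ (<-≤-trans (rankIn<classSize cu) (m≤m+n _ _)))
  ... | true  | false = contradiction (sym eq) (<⇒≢ (<-≤-trans (rankIn<classSize cv) (m≤m+n _ _)))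

  rankIn-step : ∀ {b p v} → p ≺ v → colour p ≡ b → (∀ {w} → p ≺ w → w ≺ v → colour w ≢ b) →
                rankIn b v ≡ suc (rankIn b p)
  rankIn-step {b} {p} {v} p≺v cp gap = begin
    rankIn b v
      ≡⟨ count-≐ (colouredBefore? b v) (colouredBefore? b p ∪? (_≟ᶠ p)) split (allFin n) ⟩
    count (colouredBefore? b p ∪? (_≟ᶠ p)) (allFin n)
      ≡⟨ count-∪ _ _ (λ (_ , w≺p) w≡p → <-irrefl (cong key w≡p) w≺p) (allFin n) ⟩
    rankIn b p + count (_≟ᶠ p) (allFin n)
      ≡⟨ cong (rankIn b p +_) (count-≡1 (_≟ᶠ p) (allFin⁺ n) (∈-allFin p) refl (λ _ w≡p → w≡p)) ⟩
    rankIn b p + 1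
      ≡⟨ +-comm (rankIn b p) 1 ⟩
    suc (rankIn b p) ∎
    where
    open ≡-Reasoning
    split : (λ w → colour w ≡ b × w ≺ v) ≐ (λ w → (colour w ≡ b × w ≺ p) ⊎ w ≡ p)
    split = to , [ (λ (cw , w≺p) → cw , <-trans w≺p p≺v) , (λ { refl → cp , p≺v }) ]′
      where
      to : ∀ {w} → colour w ≡ b × w ≺ v → (colour w ≡ b × w ≺ p) ⊎ w ≡ p
      to {w} (cw , w≺v) with <-cmp (key w) (key p)
      ... | tri< w≺p _ _ = inj₁ (cw , w≺p)
      ... | tri≈ _ same _ = inj₂ (key-injective same)
      ... | tri> _ _ p≺w = contradiction cw (gap p≺w w≺v)

  -- From p to v only the colour class of p gains a member, p itself (rankIn-step), so the labels
  -- of p and v together count every vertex before v, shifted by the size of the false class.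
  label-sum : ∀ {p v} → p ≺ v → colour p ≢ colour v →
              (∀ {w} → p ≺ w → w ≺ v → colour w ≡ colour v) →
              suc (label p + label v) ≡ classSize false + rank v
  label-sum {p} {v} p≺v cp≢cv between with colour p in cp | colour v in cv
  ... | false | false = contradiction refl cp≢cv
  ... | true  | true  = contradiction refl cp≢cv
  ... | false | true  = begin
    suc (rankIn false p + (classSize false + rankIn true v))
      ≡⟨ shuffle (rankIn false p) (classSize false) (rankIn true v) ⟩
    classSize false + (suc (rankIn false p) + rankIn true v)
      ≡⟨ cong (λ r → classSize false + (r + rankIn true v)) step ⟨
    classSize false + (rankIn false v + rankIn true v)
      ≡⟨ cong (classSize false +_) (rank-split v) ⟨
    classSize false + rank v ∎
    where
    open ≡-Reasoning
    shuffle : ∀ a c r → suc (a + (c + r)) ≡ c + (suc a + r)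
    shuffle = solve-∀
    step : rankIn false v ≡ suc (rankIn false p)
    step = rankIn-step p≺v cp (λ p≺w w≺v cw → not-¬ cw (between p≺w w≺v))
  ... | true  | false = begin
    suc (classSize false + rankIn true p + rankIn false v)
      ≡⟨ shuffle (classSize false) (rankIn true p) (rankIn false v) ⟩
    classSize false + (rankIn false v + suc (rankIn true p))
      ≡⟨ cong (λ r → classSize false + (rankIn false v + r)) step ⟨
    classSize false + (rankIn false v + rankIn true v)
      ≡⟨ cong (classSize false +_) (rank-split v) ⟨
    classSize false + rank v ∎
    where
    open ≡-Reasoning
    shuffle : ∀ c a r → suc (c + a + r) ≡ c + (r + suc a)
    shuffle = solve-∀
    step : rankIn true v ≡ suc (rankIn true p)
    step = rankIn-step p≺v cp (λ p≺w w≺v cw → not-¬ (between p≺w w≺v) cw)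

module _ {k : ℕ} .{{_ : NonZero k}} (G : SimpleGraph (suc k)) (g : Fin (suc k) → ℕ)
         (g<1+k : ∀ v → g v < suc k) (g-injective : ∀ {u v} → g u ≡ g v → u ≡ v) where

  private
    f : Fin (suc k) → Fin k
    f v = g v mod k

  mod-vcount-positive : ∀ a → 1 ≤ vcount G f a
  mod-vcount-positive a =
    let v , gv≡a = injective⇒onto g g<1+k g-injective (m<n⇒m<1+n (toℕ<n a))
        fv≡a = toℕ-injective (trans (toℕ-mod (g v)) (trans (cong (_% k) gv≡a) (m<n⇒m%n≡m (toℕ<n a))))
    in filter-some (λ v → f v ≟ᶠ a) (lose (∈-allFin v) fv≡a)

  mod-vcount-≤2 : ∀ a → vcount G f a ≤ 2
  mod-vcount-≤2 a = begin
    vcount G f a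
      ≤⟨ count-mono-≤ (λ v → f v ≟ᶠ a) (g≡? (toℕ a) ∪? g≡? k) g≡a∨k (allFin _) ⟩
    count (g≡? (toℕ a) ∪? g≡? k) (allFin _)
      ≡⟨ count-∪ (g≡? (toℕ a)) (g≡? k) (λ ga gk → <⇒≢ (toℕ<n a) (trans (sym ga) gk)) (allFin _) ⟩
    count (g≡? (toℕ a)) (allFin _) + count (g≡? k) (allFin _)
      ≤⟨ +-mono-≤ (at-most-one (toℕ a)) (at-most-one k) ⟩
    2 ∎
    where
    open ≤-Reasoning
    g≡? : ∀ t → Decidable (λ v → g v ≡ t)
    g≡? t v = g v ≟ t
    at-most-one : ∀ t → count (g≡? t) (allFin _) ≤ 1
    at-most-one t = count-≤1 (g≡? t) (allFin⁺ _) (λ _ _ gu gv → g-injective (trans gu (sym gv)))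
    g≡a∨k : ∀ {v} → f v ≡ a → g v ≡ toℕ a ⊎ g v ≡ k
    g≡a∨k {v} fv≡a with m≤n⇒m<n∨m≡n (s≤s⁻¹ (g<1+k v))
    ... | inj₂ gv≡k = inj₂ gv≡k
    ... | inj₁ gv<k = inj₁ (trans (sym (m<n⇒m%n≡m gv<k)) (trans (sym (toℕ-mod (g v))) (cong toℕ fv≡a)))

record ColouredParentOrder {n : ℕ} (G : SimpleGraph n) : Set where
  field
    key             : Fin n → ℕ
    key-injective   : ∀ {u v} → key u ≡ key v → u ≡ v
    colour          : Fin n → Bool
    root            : Fin n
    parent          : Fin n → Fin n
    root-first      : ∀ w → ¬ key w < key root
    parent-adjacent : ∀ {v} → v ≢ root → Adj G v (parent v)
    parent-before   : ∀ {v} → v ≢ root → key (parent v) < key v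
    parent-colour   : ∀ {v} → v ≢ root → colour (parent v) ≢ colour v
    between-colour  : ∀ {v w} → v ≢ root → key (parent v) < key w → key w < key v → colour w ≡ colour v
    edge-to-parent  : ∀ {x y} → Adj G x y → (y ≢ root × x ≡ parent y) ⊎ (x ≢ root × y ≡ parent x)

module _ {k : ℕ} .{{_ : NonZero k}} {G : SimpleGraph (suc k)} (order : ColouredParentOrder G) where

  open ColouredParentOrder order
  open ColourMajorLabelling key key-injective colour

  cordialLabel : Fin (suc k) → Fin k
  cordialLabel v = label v mod k

  rank-root : rank root ≡ 0
  rank-root = cong length (filter-none (_≺? root) (All.universal root-first (allFin _)))

  parent-label-sum : ∀ {v r} → v ≢ root → rank v ≡ suc r →
                     label v + label (parent v) ≡ classSize false + r
  parent-label-sum {v} {r} v≢root rank≡ = suc-injective (begin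
    suc (label v + label (parent v))
      ≡⟨ cong suc (+-comm (label v) _) ⟩
    suc (label (parent v) + label v)
      ≡⟨ label-sum (parent-before v≢root) (parent-colour v≢root) (between-colour v≢root) ⟩
    classSize false + rank v
      ≡⟨ cong (classSize false +_) rank≡ ⟩
    classSize false + suc r
      ≡⟨ +-suc _ r ⟩
    suc (classSize false + r) ∎)
    where open ≡-Reasoning

  parentEdge : Fin (suc k) → Fin (suc k) × Fin (suc k)
  parentEdge v = orient G v (parent v)

  toℕ-weight : ∀ x y → toℕ (weight G cordialLabel (x , y)) ≡ (label x + label y) % k
  toℕ-weight x y = begin
    toℕ (weight G cordialLabel (x , y))
      ≡⟨ toℕ-mod _ ⟩
    (toℕ (label x mod k) + toℕ (label y mod k)) % k
      ≡⟨ cong₂ (λ a b → (a + b) % k) (toℕ-mod (label x)) (toℕ-mod (label y)) ⟩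
    (label x % k + label y % k) % k
      ≡⟨ %-distribˡ-+ (label x) (label y) k ⟨
    (label x + label y) % k ∎
    where open ≡-Reasoning

  toℕ-weight-orient : ∀ x y → toℕ (weight G cordialLabel (orient G x y)) ≡ (label x + label y) % k
  toℕ-weight-orient x y with toℕ x <? toℕ y
  ... | yes _ = toℕ-weight x y
  ... | no  _ = trans (toℕ-weight y x) (cong (_% k) (+-comm (label y) (label x)))

  child-rank : ∀ {v} → v ≢ root → ∃ λ r → rank v ≡ suc r
  child-rank {v} v≢root with rank v | rank-mono (parent-before v≢root)
  ... | suc r | _ = r , refl

  parentEdge-weight : ∀ {v r} → v ≢ root → rank v ≡ suc r →
                      toℕ (weight G cordialLabel (parentEdge v)) ≡ (classSize false + r) % k
  parentEdge-weight {v} v≢root rank≡ =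
    trans (toℕ-weight-orient v (parent v)) (cong (_% k) (parent-label-sum v≢root rank≡))

  edge-is-parentEdge : ∀ {e} → e ∈ edges G → ∃ λ v → v ≢ root × e ≡ parentEdge v
  edge-is-parentEdge {x , y} e∈ with x<y , xy ← ∈-edges⁻ G e∈ | edge-to-parent xy
  ... | inj₁ (y≢root , refl) = y , y≢root , sym (orient-> G x<y)
  ... | inj₂ (x≢root , refl) = x , x≢root , sym (orient-< G x<y)

  parentEdge-weight-injective : ∀ {u v} → u ≢ root → v ≢ root →
      weight G cordialLabel (parentEdge u) ≡ weight G cordialLabel (parentEdge v) → u ≡ v
  parentEdge-weight-injective {u} {v} u≢root v≢root eq =
    let r , rank-u = child-rank u≢root
        s , rank-v = child-rank v≢root
        r≡s = [m+i]%d≡[m+j]%d⇒i≡j _ (below-k rank-u) (below-k rank-v)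
                (trans (sym (parentEdge-weight u≢root rank-u))
                       (trans (cong toℕ eq) (parentEdge-weight v≢root rank-v)))
    in rank-injective (trans rank-u (trans (cong suc r≡s) (sym rank-v)))
    where
    below-k : ∀ {w r} → rank w ≡ suc r → r < k
    below-k {w} rank≡ = s≤s⁻¹ (subst (_< suc k) rank≡ (rank<n w))

  parentEdge-weight-onto : ∀ c → ∃ λ v → v ≢ root × weight G cordialLabel (parentEdge v) ≡ c
  parentEdge-weight-onto c =
    let t , shift-t = injective⇒onto shift (λ _ → m%n<n _ k) shift-injective (toℕ<n c)
        v , rank-v = injective⇒onto rank rank<n rank-injective (s≤s (toℕ<n t))
        v≢root = λ v≡root → 0≢1+n (trans (sym (trans (cong rank v≡root) rank-root)) rank-v)
    in v , v≢root , toℕ-injective (trans (parentEdge-weight v≢root rank-v) shift-t)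
    where
    shift : Fin k → ℕ
    shift t = (classSize false + toℕ t) % k
    shift-injective : ∀ {s t} → shift s ≡ shift t → s ≡ t
    shift-injective eq = toℕ-injective ([m+i]%d≡[m+j]%d⇒i≡j _ (toℕ<n _) (toℕ<n _) eq)

  ecount-≡1 : ∀ c → ecount G cordialLabel c ≡ 1
  ecount-≡1 c =
    let v , v≢root , weight≡c = parentEdge-weight-onto c
        only-parentEdge : ∀ {e} → e ∈ edges G → weight G cordialLabel e ≡ c → e ≡ parentEdge v
        only-parentEdge e∈ we≡c =
          let u , u≢root , e≡ = edge-is-parentEdge e∈
          in trans e≡ (cong parentEdge (parentEdge-weight-injective u≢root v≢root
               (trans (cong (weight G cordialLabel) (sym e≡)) (trans we≡c (sym weight≡c)))))
    in count-≡1 (λ e → weight G cordialLabel e ≟ᶠ c) (edges-unique G)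
         (orient-∈-edges G (parent-adjacent v≢root)) weight≡c only-parentEdge

  cordialLabel-isCordial : IsKCordial G cordialLabel × (∀ c → ecount G cordialLabel c ≡ 1)
  cordialLabel-isCordial =
    ( (λ a b → ≤-trans (mod-vcount-≤2 G label label<n label-injective a)
                       (s≤s (mod-vcount-positive G label label<n label-injective b)))
    , (λ a b → subst₂ _≤_ (sym (ecount-≡1 a)) (cong suc (sym (ecount-≡1 b))) (s≤s z≤n)))
    , ecount-≡1

module LexicographicKey {n : ℕ} .{{_ : NonZero n}} (level : Fin n → ℕ) where

  key : Fin n → ℕ
  key v = toℕ v + level v * n

  key-injective : ∀ {u v} → key u ≡ key v → u ≡ v
  key-injective {u} {v} eq = toℕ-injective (trans (sym (key%n u)) (trans (cong (_% n) eq) (key%n v)))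
    where
    key%n : ∀ w → key w % n ≡ toℕ w
    key%n w = trans ([m+kn]%n≡m%n (toℕ w) (level w) n) (m<n⇒m%n≡m (toℕ<n w))

  level-<⇒key-< : ∀ {u v} → level u < level v → key u < key v
  level-<⇒key-< {u} {v} lu<lv = begin-strict
    toℕ u + level u * n  <⟨ +-monoˡ-< (level u * n) (toℕ<n u) ⟩
    suc (level u) * n    ≤⟨ *-monoˡ-≤ n lu<lv ⟩
    level v * n          ≤⟨ m≤n+m (level v * n) (toℕ v) ⟩
    key v                ∎
    where open ≤-Reasoning

  key-<⇒level-≤ : ∀ {u v} → key u < key v → level u ≤ level v
  key-<⇒level-≤ ku<kv = ≮⇒≥ (λ lv<lu → <-asym ku<kv (level-<⇒key-< lv<lu))

-- Level 2i is spine vertex i and level 2i+1 its leaves, at distance i and i+1 from the root;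
-- the colour of a level is the parity of that distance.
levelColour : ℕ → Bool
levelColour 0             = false
levelColour 1             = true
levelColour (suc (suc ℓ)) = not (levelColour ℓ)

levelColour-odd : ∀ i → levelColour (suc (2 * i)) ≡ not (levelColour (2 * i))
levelColour-odd zero    = refl
levelColour-odd (suc i) =
  subst (λ ℓ → levelColour (suc ℓ) ≡ not (levelColour ℓ)) (sym (*-suc 2 i)) (cong not (levelColour-odd i))

levelColour-after-even : ∀ {i ℓ} → 2 * i < ℓ → ℓ ≤ 2 * suc i → levelColour ℓ ≡ not (levelColour (2 * i))
levelColour-after-even {i} {ℓ} 2i<ℓ ℓ≤2i+2 with m≤n⇒m<n∨m≡n (subst (ℓ ≤_) (*-suc 2 i) ℓ≤2i+2)
... | inj₂ refl = refl
... | inj₁ ℓ<2i+2 rewrite ≤-antisym (s≤s⁻¹ ℓ<2i+2) 2i<ℓ = levelColour-odd i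

module CaterpillarOrder {k : ℕ} (T : SimpleGraph (suc k)) (acyclic : ¬ HasCycle T)
                        (P : List (Fin (suc k))) (P≢[] : P ≢ []) (P-unique : Unique P)
                        (P-linked : Linked (Adj T) P) (near : ∀ v → OnOrAdjacent T v P) where

  open import Data.List.Membership.DecPropositional (_≟ᶠ_ {suc k}) using (_∈?_)

  m : ℕ
  m = length P

  spine : ℕ → Fin (suc k)
  spine = nth Fin.zero P

  spine-injective : ∀ {i j} → i < m → j < m → spine i ≡ spine j → i ≡ j
  spine-injective = nth-injective Fin.zero P-unique

  spine-adjacent : ∀ {i} → suc i < m → Adj T (spine i) (spine (suc i))
  spine-adjacent = nth-linked Fin.zero P-linked

  open AcyclicPath T acyclic spine spine-injective spine-adjacent

  root : Fin (suc k)
  root = spine 0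

  data Position (v : Fin (suc k)) : Set where
    on-spine  : ∀ {i} → i < m → spine i ≡ v → Position v
    off-spine : ∀ {i} → i < m → Adj T v (spine i) → OffPath v → Position v

  position : ∀ v → Position v
  position v with v ∈? P
  ... | yes v∈P = let i , i<m , spine-i≡v = ∈⇒nth Fin.zero v∈P in on-spine i<m spine-i≡v
  ... | no  v∉P with near v
  ...   | w , w∈P , inj₁ refl = contradiction w∈P v∉P
  ...   | w , w∈P , inj₂ vw with i , i<m , refl ← ∈⇒nth Fin.zero w∈P =
          off-spine i<m vw (λ j<m spine-j≡v → v∉P (subst (_∈ P) spine-j≡v (nth-∈ Fin.zero j<m)))

  levelAt : ∀ {v} → Position v → ℕ
  levelAt (on-spine  {i} _ _)   = 2 * i
  levelAt (off-spine {i} _ _ _) = suc (2 * i)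

  parentAt : ∀ {v} → Position v → Fin (suc k)
  parentAt (on-spine {zero}  _ _)   = root   -- junk: the root has no parent
  parentAt (on-spine {suc i} _ _)   = spine i
  parentAt (off-spine {i}    _ _ _) = spine i

  level : Fin (suc k) → ℕ
  level v = levelAt (position v)

  parent : Fin (suc k) → Fin (suc k)
  parent v = parentAt (position v)

  0<m : 0 < m
  0<m = ≢[]⇒0<length P≢[]

  spine-suc≢root : ∀ {i} → suc i < m → spine (suc i) ≢ root
  spine-suc≢root 1+i<m eq with spine-injective 1+i<m 0<m eq
  ... | ()

  OffPath⇒≢root : ∀ {v} → OffPath v → v ≢ root
  OffPath⇒≢root off v≡root = off 0<m (sym v≡root)

  spine-level : ∀ {i} → i < m → level (spine i) ≡ 2 * i
  spine-level {i} i<m with position (spine i)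
  ... | on-spine j<m spine-j≡spine-i = cong (2 *_) (spine-injective j<m i<m spine-j≡spine-i)
  ... | off-spine _ _ off           = contradiction refl (off i<m)

  even-level⇒spine : ∀ {w i} → level w ≡ 2 * i → w ≡ spine i
  even-level⇒spine {w} {i} eq with position w
  ... | on-spine {j} _ refl  = cong spine (*-cancelˡ-≡ j i 2 eq)
  ... | off-spine {j} _ _ _ = contradiction (sym eq) (even≢odd i j)

  spine-parent : ∀ {i} → suc i < m → parent (spine (suc i)) ≡ spine i
  spine-parent {i} 1+i<m with position (spine (suc i))
  ... | off-spine _ _ off = contradiction refl (off 1+i<m)
  ... | on-spine j<m eq with spine-injective j<m 1+i<m eq
  ...   | refl = refl

  off-spine-parent : ∀ {v i} → OffPath v → i < m → Adj T v (spine i) → parent v ≡ spine i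
  off-spine-parent {v} off i<m vi with position v
  ... | on-spine j<m spine-j≡v = contradiction spine-j≡v (off j<m)
  ... | off-spine j<m vj _     = cong spine (off-path-neighbour-unique off j<m i<m vj vi)

  record SpineParent (v : Fin (suc k)) (ℓ : ℕ) (p : Fin (suc k)) : Set where
    field
      index        : ℕ
      index<m      : index < m
      parent≡spine : p ≡ spine index
      adjacent     : Adj T v p
      level-above  : 2 * index < ℓ
      level-within : ℓ ≤ 2 * suc index

  spineParentAt : ∀ {v} (pos : Position v) → v ≢ root →
                  SpineParent v (levelAt pos) (parentAt pos)
  spineParentAt (on-spine {zero} _ refl) v≢root = contradiction refl v≢root
  spineParentAt (on-spine {suc i} 1+i<m refl) _ = record
    { index = i ; index<m = <-trans (n<1+n i) 1+i<m ; parent≡spine = refl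
    ; adjacent = Adj-sym T (spine-adjacent 1+i<m)
    ; level-above = *-monoʳ-< 2 (n<1+n i) ; level-within = ≤-refl }
  spineParentAt (off-spine {i} i<m vi _) _ = record
    { index = i ; index<m = i<m ; parent≡spine = refl ; adjacent = vi
    ; level-above = n<1+n _ ; level-within = subst (suc (2 * i) ≤_) (sym (*-suc 2 i)) (n≤1+n _) }

  spineParent : ∀ {v} → v ≢ root → SpineParent v (level v) (parent v)
  spineParent {v} = spineParentAt (position v)

  edge-to-parentAt : ∀ {x y} → Position x → Position y → Adj T x y →
                     (y ≢ root × x ≡ parent y) ⊎ (x ≢ root × y ≡ parent x)
  edge-to-parentAt (on-spine i<m refl) (on-spine j<m refl) xy with path-chord i<m j<m xy
  ... | inj₁ refl = inj₁ (spine-suc≢root j<m , sym (spine-parent j<m))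
  ... | inj₂ refl = inj₂ (spine-suc≢root i<m , sym (spine-parent i<m))
  edge-to-parentAt (on-spine i<m refl) (off-spine j<m yj offy) xy
    with refl ← off-path-neighbour-unique offy i<m j<m (Adj-sym T xy) yj =
    inj₁ (OffPath⇒≢root offy , sym (off-spine-parent offy i<m (Adj-sym T xy)))
  edge-to-parentAt (off-spine i<m xi offx) (on-spine j<m refl) xy
    with refl ← off-path-neighbour-unique offx i<m j<m xi xy =
    inj₂ (OffPath⇒≢root offx , sym (off-spine-parent offx j<m xy))
  edge-to-parentAt (off-spine i<m xi offx) (off-spine j<m yj offy) xy =
    contradiction xy (off-path-edge offx offy i<m j<m xi yj)

  open LexicographicKey level

  colour : Fin (suc k) → Bool
  colour v = levelColour (level v)

  module _ {v} (v≢root : v ≢ root) where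
    open SpineParent (spineParent v≢root)

    parent-level : level (parent v) ≡ 2 * index
    parent-level = trans (cong level parent≡spine) (spine-level index<m)

    parent-level-< : level (parent v) < level v
    parent-level-< = subst (_< level v) (sym parent-level) level-above

    colour-child : colour v ≡ not (levelColour (2 * index))
    colour-child = levelColour-after-even level-above level-within

    colour-between : ∀ {w} → key (parent v) < key w → key w < key v → colour w ≡ colour v
    colour-between {w} pw vw = trans (levelColour-after-even 2i<ℓ ℓ≤2i+2) (sym colour-child)
      where
      2i≤ℓ : 2 * index ≤ level w
      2i≤ℓ = subst (_≤ level w) parent-level (key-<⇒level-≤ pw)
      2i<ℓ : 2 * index < level w
      2i<ℓ = ≤∧≢⇒< 2i≤ℓ λ 2i≡ℓ →
        <-irrefl (cong key (trans parent≡spine (sym (even-level⇒spine (sym 2i≡ℓ))))) pw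
      ℓ≤2i+2 : level w ≤ 2 * suc index
      ℓ≤2i+2 = ≤-trans (key-<⇒level-≤ vw) level-within

  order : ColouredParentOrder T
  order = record
    { key             = key
    ; key-injective   = key-injective
    ; colour          = colour
    ; root            = root
    ; parent          = parent
    ; root-first      = λ w kw<kr → <-irrefl (cong key (level-≤-root⇒root (key-<⇒level-≤ kw<kr))) kw<kr
    ; parent-adjacent = λ v≢root → SpineParent.adjacent (spineParent v≢root)
    ; parent-before   = λ v≢root → level-<⇒key-< (parent-level-< v≢root)
    ; parent-colour   = λ v≢root eq →
                          not-¬ (cong levelColour (parent-level v≢root)) (trans eq (colour-child v≢root))
    ; between-colour  = λ v≢root → colour-between v≢root
    ; edge-to-parent  = λ {x} {y} → edge-to-parentAt (position x) (position y)
    }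
    where
    level-≤-root⇒root : ∀ {w} → level w ≤ level root → w ≡ root
    level-≤-root⇒root {w} lw≤ = even-level⇒spine (n≤0⇒n≡0 (subst (level w ≤_) (spine-level 0<m) lw≤))

proposition2p7 : (k : ℕ) .{{_ : NonZero k}} (T : SimpleGraph (suc k)) (r : Fin (suc k))
  → IsCaterpillar T
  → (P : List (Fin (suc k))) → IsLongestPath T P
  → (∃ λ v → IsEndpoint T v P × Adj T r v)
  → ∃ λ (f : Fin (suc k) → Fin k) → IsKCordial T f × (∀ c → ecount T f c ≡ 1)
proposition2p7 k T _ ((_ , acyclic) , S , ((S≢[] , S-unique , S-linked) , _) , near) _ _ _ =
  cordialLabel order , cordialLabel-isCordial order
  where open CaterpillarOrder T acyclic S S≢[] S-unique S-linked near
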